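{- Suppose that $1/n \ll \alpha \ll \gamma \ll 1$. Let $G$ be a tournament on $n$ vertices in which at least one of the following holds: (i) $d^+(v) \geq (1-\alpha)(n-1)/2$ for every $v \in G$; (ii) $d^-(v) \geq (1-\alpha)(n-1)/2$ for every $v \in G$; (iii) $d^+(v) \leq (1+\alpha)(n-1)/2$ for every $v \in G$; (iv) $d^-(v) \leq (1+\alpha)(n-1)/2$ for every $v \in G$. Then $G$ contains a $\gamma$-almost-regular subtournament $G'$ on at least $(1-\gamma)n$ vertices.
   Context: $d^+(v)$ and $d^-(v)$ denote out- and indegree. A tournament $H$ is $\gamma$-almost-regular if every vertex $v$ of $H$ has $d^+_H(v), d^-_H(v) \geq (1-\gamma)(|H|-1)/2$. Hierarchy notation: $a \ll b$ means that for every $b>0$ there exists $a_0>0$ such that the statement holds for all $0 < a \leq a_0$; hierarchies with several constants are to be read from right to left (constants chosen right to left, each sufficiently small depending on those to its right); $n$ denotes a positive integer. -}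

module Defs where

open import Data.Nat using (ℕ)
open import Data.Bool using (Bool; true; false; not; if_then_else_)
open import Data.Fin using (Fin)
open import Data.Fin.Subset using (Subset; inside; outside; _∈_; ∣_∣; _∩_; ⊤)
open import Data.Vec using (tabulate)
open import Data.Integer using (+_)
open import Data.Rational using (ℚ; _/_; _≤_; _*_; _-_; _+_; ½; 1ℚ)
open import Data.Product using (_×_)
open import Relation.Binary.PropositionalEquality using (_≡_; _≢_)
open import Data.Sum using (_⊎_)

-- A digraph on vertex set Fin n: adj u v ≡ true means the edge u → v.
Digraph : ℕ → Set
Digraph n = Fin n → Fin n → Bool

IsTournament : {n : ℕ} → Digraph n → Set
IsTournament {n} adj =
  ((i : Fin n) → adj i i ≡ false) ×
  ((i j : Fin n) → i ≢ j → adj j i ≡ not (adj i j))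

ℕ→ℚ : ℕ → ℚ
ℕ→ℚ k = + k / 1

outNbhd : {n : ℕ} → Digraph n → Fin n → Subset n
outNbhd adj v = tabulate (λ j → if adj v j then inside else outside)

inNbhd : {n : ℕ} → Digraph n → Fin n → Subset n
inNbhd adj v = tabulate (λ j → if adj j v then inside else outside)

outdegIn : {n : ℕ} → Digraph n → Subset n → Fin n → ℕ
outdegIn adj S v = ∣ S ∩ outNbhd adj v ∣

indegIn : {n : ℕ} → Digraph n → Subset n → Fin n → ℕ
indegIn adj S v = ∣ S ∩ inNbhd adj v ∣

d⁺ : {n : ℕ} → Digraph n → Fin n → ℕ
d⁺ adj v = outdegIn adj ⊤ v

d⁻ : {n : ℕ} → Digraph n → Fin n → ℕ
d⁻ adj v = indegIn adj ⊤ v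

AlmostRegularOn : {n : ℕ} → ℚ → Digraph n → Subset n → Set
AlmostRegularOn {n} γ adj S =
  (v : Fin n) → v ∈ S →
    ((1ℚ - γ) * (ℕ→ℚ ∣ S ∣ - 1ℚ) * ½ ≤ ℕ→ℚ (outdegIn adj S v)) ×
    ((1ℚ - γ) * (ℕ→ℚ ∣ S ∣ - 1ℚ) * ½ ≤ ℕ→ℚ (indegIn adj S v))

DegreeCondition : {n : ℕ} → ℚ → Digraph n → Set
DegreeCondition {n} α adj =
  ((v : Fin n) → (1ℚ - α) * (ℕ→ℚ n - 1ℚ) * ½ ≤ ℕ→ℚ (d⁺ adj v)) ⊎
  (((v : Fin n) → (1ℚ - α) * (ℕ→ℚ n - 1ℚ) * ½ ≤ ℕ→ℚ (d⁻ adj v)) ⊎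
  (((v : Fin n) → ℕ→ℚ (d⁺ adj v) ≤ (1ℚ + α) * (ℕ→ℚ n - 1ℚ) * ½) ⊎
   ((v : Fin n) → ℕ→ℚ (d⁻ adj v) ≤ (1ℚ + α) * (ℕ→ℚ n - 1ℚ) * ½)))

-- Reversing every edge swaps out- and in-degrees, and d⁺(v) + d⁻(v) = n − 1 turns an upper bound on
-- one into a lower bound on the other, so all four conditions reduce to the minimum out-degree bound
-- d⁺(v) ≥ (1 − α)(n − 1)/2. The out-degrees average exactly (n − 1)/2, so Markov's inequality applied
-- to the excess over that minimum shows that at most n/8L vertices have out-degree above
-- (1 + 1/2L)(n − 1)/2, where 1/L ≤ γ and α = 1/16L². Deleting them removes few out-neighbours of any
-- remaining vertex, and a remaining vertex, whose out-degree in G is at most about (n − 1)/2, keeps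
-- about half of the other remaining vertices as in-neighbours.

module Submission where

open import Defs

module Arithmetic where
  open import Data.List using (_∷_; [])
  open import Data.Nat
  open import Data.Nat.Properties
  open import Data.Nat.Tactic.RingSolver using (solve)
  open import Relation.Binary.PropositionalEquality using (_≡_; refl; cong; sym)

  -- d ≥ (1 − 1/k)·m/2, d ≤ (1 + 1/k)·m/2 and s ≥ (1 − 1/k)·n, with the denominators cleared
  record AlmostHalf≥ (k m d : ℕ) : Set where
    constructor almostHalf≥
    field cleared : k * m ≤ 2 * k * d + m

  record AlmostHalf≤ (k m d : ℕ) : Set where
    constructor almostHalf≤
    field cleared : 2 * k * d ≤ k * m + m

  record AlmostAll (k n s : ℕ) : Set where
    constructor almostAll
    field cleared : k * n ≤ k * s + n

  AlmostHalf≤⇒AlmostHalf≥-complement : ∀ {k m d e} → d + e ≡ m → AlmostHalf≤ k m d → AlmostHalf≥ k m e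
  AlmostHalf≤⇒AlmostHalf≥-complement {k} {_} {d} {e} refl (almostHalf≤ d≤) =
    almostHalf≥ (+-cancelˡ-≤ (2 * k * d) _ _ (begin
    2 * k * d + k * (d + e)                 ≤⟨ +-monoˡ-≤ (k * (d + e)) d≤ ⟩
    k * (d + e) + (d + e) + k * (d + e)     ≡⟨ solve (k ∷ d ∷ e ∷ []) ⟩
    2 * k * d + (2 * k * e + (d + e))       ∎))
    where open ≤-Reasoning

  below-threshold⇒AlmostHalf≤ : ∀ {L K m d} .{{_ : NonZero K}} →
    2 * L * (2 * K * d + m) ≤ 2 * L * (K * m) + K * m → AlmostHalf≤ (2 * L) m d
  below-threshold⇒AlmostHalf≤ {L} {K} {m} {d} below = almostHalf≤ (*-cancelˡ-≤ K (begin
    K * (2 * (2 * L) * d)                   ≤⟨ m≤m+n (K * (2 * (2 * L) * d)) (2 * L * m) ⟩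
    K * (2 * (2 * L) * d) + 2 * L * m       ≡⟨ solve (L ∷ K ∷ m ∷ d ∷ []) ⟩
    2 * L * (2 * K * d + m)                 ≤⟨ below ⟩
    2 * L * (K * m) + K * m                 ≡⟨ solve (L ∷ K ∷ m ∷ []) ⟩
    K * (2 * L * m + m)                     ∎))
    where open ≤-Reasoning

  markov-bound⇒Kb≤2Ln : ∀ {L K m b D} .{{_ : NonZero m}} →
    suc m * (2 * L * (K * m)) + K * m * b ≤ 2 * L * (2 * K * D + suc m * m) →
    suc m + 2 * D ≡ suc m * suc m → K * b ≤ 2 * L * suc m
  markov-bound⇒Kb≤2Ln {L} {K} {m} {b} {D} markov handshake =
    *-cancelˡ-≤ m (+-cancelʳ-≤ _ _ _ (begin
      m * (K * b) + (suc m * (2 * L * (K * m)) + 2 * L * K * suc m)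
        ≡⟨ solve (L ∷ K ∷ m ∷ b ∷ []) ⟩
      suc m * (2 * L * (K * m)) + K * m * b + 2 * L * K * suc m
        ≤⟨ +-monoˡ-≤ (2 * L * K * suc m) markov ⟩
      2 * L * (2 * K * D + suc m * m) + 2 * L * K * suc m
        ≡⟨ solve (L ∷ K ∷ m ∷ D ∷ []) ⟩
      2 * L * (K * (suc m + 2 * D) + suc m * m)
        ≡⟨ cong (λ x → 2 * L * (K * x + suc m * m)) handshake ⟩
      2 * L * (K * (suc m * suc m) + suc m * m)
        ≡⟨ solve (L ∷ K ∷ m ∷ []) ⟩
      m * (2 * L * suc m) + (suc m * (2 * L * (K * m)) + 2 * L * K * suc m) ∎))
    where open ≤-Reasoning

  4Lb≤m⇒2[1+L]b≤m : ∀ {L b m} → 1 ≤ L → 4 * L * b ≤ m → 2 * suc L * b ≤ m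
  4Lb≤m⇒2[1+L]b≤m {L} {b} {m} 1≤L 4Lb≤m = begin
    2 * suc L * b      ≡⟨ solve (L ∷ b ∷ []) ⟩
    2 * b * (1 + L)    ≤⟨ *-monoʳ-≤ (2 * b) (+-monoˡ-≤ L 1≤L) ⟩
    2 * b * (L + L)    ≡⟨ solve (L ∷ b ∷ []) ⟩
    4 * L * b          ≤⟨ 4Lb≤m ⟩
    m                  ∎
    where open ≤-Reasoning

  outdeg-after-deletion : ∀ {L K m d o b t} .{{_ : NonZero K}} → 1 ≤ L → 2 * L ≤ K →
    AlmostHalf≥ K m d → d ≤ o + b → t + b ≡ m → 4 * L * b ≤ m → AlmostHalf≥ L t o
  outdeg-after-deletion {L} {K} {_} {d} {o} {b} {t} 1≤L 2L≤K (almostHalf≥ d≥) d≤o+b refl few =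
    almostHalf≥ (*-cancelˡ-≤ K (+-cancelʳ-≤ _ _ _ (begin
      K * (L * t) + (2 * K * L * b + L * (t + b))   ≡⟨ solve (L ∷ K ∷ b ∷ t ∷ []) ⟩
      K * L * t + K * L * b + (L * (t + b) + K * L * b)
        ≤⟨ +-monoʳ-≤ (K * L * t + K * L * b) slack ⟩
      K * L * t + K * L * b + K * t                 ≡⟨ solve (L ∷ K ∷ b ∷ t ∷ []) ⟩
      L * (K * (t + b)) + K * t                     ≤⟨ +-monoˡ-≤ (K * t) (*-monoʳ-≤ L d≥) ⟩
      L * (2 * K * d + (t + b)) + K * t
        ≤⟨ +-monoˡ-≤ (K * t) (*-monoʳ-≤ L (+-monoˡ-≤ (t + b) (*-monoʳ-≤ (2 * K) d≤o+b))) ⟩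
      L * (2 * K * (o + b) + (t + b)) + K * t       ≡⟨ solve (L ∷ K ∷ o ∷ b ∷ t ∷ []) ⟩
      K * (2 * L * o + t) + (2 * K * L * b + L * (t + b)) ∎)))
    where
    open ≤-Reasoning
    slack : L * (t + b) + K * L * b ≤ K * t
    slack = +-cancelʳ-≤ (K * b) _ _ (*-cancelˡ-≤ 2 (begin
      2 * (L * (t + b) + K * L * b + K * b)  ≡⟨ solve (L ∷ K ∷ b ∷ t ∷ []) ⟩
      2 * L * (t + b) + K * (2 * suc L * b)
        ≤⟨ +-mono-≤ (*-monoˡ-≤ (t + b) 2L≤K) (*-monoʳ-≤ K (4Lb≤m⇒2[1+L]b≤m 1≤L few)) ⟩
      K * (t + b) + K * (t + b)              ≡⟨ solve (K ∷ b ∷ t ∷ []) ⟩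
      2 * (K * t + K * b)                    ∎))

  indeg-after-deletion : ∀ {L m d o i b t} → 1 ≤ L → AlmostHalf≤ (2 * L) m d → o ≤ d →
    o + i ≡ t → t + b ≡ m → 4 * L * b ≤ m → AlmostHalf≥ L t i
  indeg-after-deletion {L} {_} {d} {o} {i} {b} {t} 1≤L (almostHalf≤ d≤) o≤d o+i≡t refl few =
    almostHalf≥ (*-cancelˡ-≤ 2 (+-cancelʳ-≤ _ _ _ (begin
      2 * (L * t) + (2 * L * (t + b) + (t + b))  ≤⟨ +-monoʳ-≤ (2 * (L * t)) slack ⟩
      2 * (L * t) + (2 * L * t + 2 * t)          ≡⟨ solve (L ∷ t ∷ []) ⟩
      2 * (2 * L) * t + 2 * t                    ≡⟨ cong (λ x → 2 * (2 * L) * x + 2 * t) (sym o+i≡t) ⟩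
      2 * (2 * L) * (o + i) + 2 * t              ≡⟨ solve (L ∷ o ∷ i ∷ t ∷ []) ⟩
      2 * (2 * L) * o + 2 * (2 * L * i + t)      ≤⟨ +-monoˡ-≤ (2 * (2 * L * i + t)) (*-monoʳ-≤ (2 * (2 * L)) o≤d) ⟩
      2 * (2 * L) * d + 2 * (2 * L * i + t)      ≤⟨ +-monoˡ-≤ (2 * (2 * L * i + t)) d≤ ⟩
      2 * L * (t + b) + (t + b) + 2 * (2 * L * i + t) ≡⟨ +-comm (2 * L * (t + b) + (t + b)) _ ⟩
      2 * (2 * L * i + t) + (2 * L * (t + b) + (t + b)) ∎)))
    where
    open ≤-Reasoning
    slack : 2 * L * (t + b) + (t + b) ≤ 2 * L * t + 2 * t
    slack = +-cancelʳ-≤ (2 * suc L * b) _ _ (begin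
      2 * L * (t + b) + (t + b) + 2 * suc L * b
        ≤⟨ +-monoʳ-≤ (2 * L * (t + b) + (t + b)) (4Lb≤m⇒2[1+L]b≤m 1≤L few) ⟩
      2 * L * (t + b) + (t + b) + (t + b)  ≡⟨ solve (L ∷ b ∷ t ∷ []) ⟩
      2 * L * t + 2 * t + 2 * suc L * b    ∎)

  AlmostAll-by-complement : ∀ {L n s b} → s + b ≡ n → L * b ≤ n → AlmostAll L n s
  AlmostAll-by-complement {L} {_} {s} {b} refl Lb≤n = almostAll (begin
    L * (s + b)        ≡⟨ *-distribˡ-+ L s b ⟩
    L * s + L * b      ≤⟨ +-monoʳ-≤ (L * s) Lb≤n ⟩
    L * s + (s + b)    ∎)
    where open ≤-Reasoning

  16L²b≤2Ln⇒4Lb≤m : ∀ {l b m} → 1 ≤ m → 16 * suc l * suc l * b ≤ 2 * suc l * suc m → 4 * suc l * b ≤ m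
  16L²b≤2Ln⇒4Lb≤m {l} {b} {m} 1≤m few = *-cancelˡ-≤ (4 * suc l) (begin
    4 * suc l * (4 * suc l * b) ≡⟨ solve (l ∷ b ∷ []) ⟩
    16 * suc l * suc l * b      ≤⟨ few ⟩
    2 * suc l * suc m           ≤⟨ *-monoʳ-≤ (2 * suc l) (+-monoˡ-≤ m 1≤m) ⟩
    2 * suc l * (m + m)         ≡⟨ solve (l ∷ m ∷ []) ⟩
    4 * suc l * m               ∎)
    where open ≤-Reasoning

  2L≤16L² : ∀ l → 2 * suc l ≤ 16 * suc l * suc l
  2L≤16L² l = ≤-trans (*-monoˡ-≤ (suc l) (s≤s (s≤s (z≤n {14})))) (m≤m*n (16 * suc l) (suc l))

module Counting where
  open import Data.Bool using (Bool; true; false; not; _∧_; if_then_else_)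
  open import Data.Bool.Properties using (T-≡)
  open import Data.Fin using (Fin; zero; suc)
  open import Data.Fin.Subset using (Subset; inside; outside; _∈_; ∣_∣; _∩_; ∁; ⊤)
  open import Data.Fin.Subset.Properties using (∣∁p∣≡n∸∣p∣; ∣p∣≤n; ∩-identityˡ; p⊆q⇒∣p∣≤∣q∣; p∩q⊆q)
  open import Data.Nat
  open import Data.Nat.Properties
  open import Algebra.Properties.Semiring.Sum +-*-semiring public
    using (sum; sum-syntax; sum-cong-≗; ∑-distrib-+; ∑-comm; *-distribˡ-sum; sum-remove)
  open import Data.Vec using ([]; _∷_; tabulate; lookup)
  open import Data.Vec.Properties using (lookup∘tabulate; lookup-zipWith; lookup-map; lookup⇒[]=)
  open import Function.Base using (_∘_)
  open import Function.Bundles using (Equivalence)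
  open import Relation.Binary.PropositionalEquality

  𝟙 : Bool → ℕ
  𝟙 true  = 1
  𝟙 false = 0

  ∑-const : ∀ n c → ∑[ i < n ] c ≡ n * c
  ∑-const zero    c = refl
  ∑-const (suc n) c = cong (c +_) (∑-const n c)

  ∑-mono-≤ : ∀ {n} {f g : Fin n → ℕ} → (∀ i → f i ≤ g i) → sum f ≤ sum g
  ∑-mono-≤ {zero}  f≤g = z≤n
  ∑-mono-≤ {suc n} f≤g = +-mono-≤ (f≤g zero) (∑-mono-≤ (λ i → f≤g (suc i)))

  ∣p∣≡∑𝟙 : ∀ {n} (p : Subset n) → ∣ p ∣ ≡ ∑[ i < n ] 𝟙 (lookup p i)
  ∣p∣≡∑𝟙 []            = refl
  ∣p∣≡∑𝟙 (inside  ∷ p) = cong suc (∣p∣≡∑𝟙 p)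
  ∣p∣≡∑𝟙 (outside ∷ p) = ∣p∣≡∑𝟙 p

  asSubset : ∀ {n} → (Fin n → Bool) → Subset n
  asSubset f = tabulate (λ i → if f i then inside else outside)

  lookup-asSubset : ∀ {n} (f : Fin n → Bool) j →
    lookup (asSubset f) j ≡ f j
  lookup-asSubset f j with f j | lookup∘tabulate (λ i → if f i then inside else outside) j
  ... | true  | eq = eq
  ... | false | eq = eq

  ∈-tabulate : ∀ {n} (f : Fin n → Bool) {v} → f v ≡ true → v ∈ tabulate f
  ∈-tabulate f {v} fv = lookup⇒[]= v (tabulate f) (trans (lookup∘tabulate f v) fv)

  ∣tabulate∣ : ∀ {n} (f : Fin n → Bool) → ∣ tabulate f ∣ ≡ ∑[ i < n ] 𝟙 (f i)
  ∣tabulate∣ f = trans (∣p∣≡∑𝟙 (tabulate f)) (sum-cong-≗ λ i → cong 𝟙 (lookup∘tabulate f i))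

  ∣∩asSubset∣ : ∀ {n} (S : Subset n) (f : Fin n → Bool) →
    ∣ S ∩ asSubset f ∣ ≡ ∑[ j < n ] 𝟙 (lookup S j ∧ f j)
  ∣∩asSubset∣ S f = trans (∣p∣≡∑𝟙 (S ∩ asSubset f)) (sum-cong-≗ λ j → cong 𝟙
    (trans (lookup-zipWith _∧_ j S (asSubset f)) (cong (lookup S j ∧_) (lookup-asSubset f j))))

  ∣⊤∩asSubset∣ : ∀ {n} (f : Fin n → Bool) →
    ∣ ⊤ ∩ asSubset f ∣ ≡ ∑[ j < n ] 𝟙 (f j)
  ∣⊤∩asSubset∣ f = trans (cong ∣_∣ (∩-identityˡ (asSubset f)))
    (trans (∣p∣≡∑𝟙 (asSubset f)) (sum-cong-≗ λ j → cong 𝟙 (lookup-asSubset f j)))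

  ∣∁p∣+∣p∣≡n : ∀ {n} (p : Subset n) → ∣ ∁ p ∣ + ∣ p ∣ ≡ n
  ∣∁p∣+∣p∣≡n p = trans (cong (_+ ∣ p ∣) (∣∁p∣≡n∸∣p∣ p)) (m∸n+n≡m (∣p∣≤n p))

  ∣p∩q∣≤∣⊤∩q∣ : ∀ {n} (p q : Subset n) → ∣ p ∩ q ∣ ≤ ∣ ⊤ ∩ q ∣
  ∣p∩q∣≤∣⊤∩q∣ p q = subst (∣ p ∩ q ∣ ≤_) (cong ∣_∣ (sym (∩-identityˡ q))) (p⊆q⇒∣p∣≤∣q∣ (p∩q⊆q p q))

  ∣⊤∩q∣≤∣∁r∩q∣+∣r∣ : ∀ {n} (q r : Subset n) → ∣ ⊤ ∩ q ∣ ≤ ∣ ∁ r ∩ q ∣ + ∣ r ∣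
  ∣⊤∩q∣≤∣∁r∩q∣+∣r∣ {n} q r = begin
    ∣ ⊤ ∩ q ∣                                   ≡⟨ cong ∣_∣ (∩-identityˡ q) ⟩
    ∣ q ∣                                       ≡⟨ ∣p∣≡∑𝟙 q ⟩
    ∑[ j < n ] 𝟙 (q′ j)                          ≤⟨ ∑-mono-≤ (λ j → pointwise (r′ j) (q′ j)) ⟩
    ∑[ j < n ] (𝟙 (not (r′ j) ∧ q′ j) + 𝟙 (r′ j)) ≡⟨ ∑-distrib-+ (λ j → 𝟙 (not (r′ j) ∧ q′ j)) (𝟙 ∘ r′) ⟩
    ∑[ j < n ] 𝟙 (not (r′ j) ∧ q′ j) + ∑[ j < n ] 𝟙 (r′ j)
      ≡⟨ sym (cong₂ _+_ (trans (∣p∣≡∑𝟙 (∁ r ∩ q)) (sum-cong-≗ (cong 𝟙 ∘ lookup-∁r∩q))) (∣p∣≡∑𝟙 r)) ⟩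
    ∣ ∁ r ∩ q ∣ + ∣ r ∣                         ∎
    where
    open ≤-Reasoning
    q′ r′ : Fin n → Bool
    q′ = lookup q
    r′ = lookup r
    lookup-∁r∩q : ∀ j → lookup (∁ r ∩ q) j ≡ not (r′ j) ∧ q′ j
    lookup-∁r∩q j = trans (lookup-zipWith _∧_ j (∁ r) q) (cong (_∧ q′ j) (lookup-map j not r))
    pointwise : ∀ x y → 𝟙 y ≤ 𝟙 (not x ∧ y) + 𝟙 x
    pointwise true  true  = ≤-refl
    pointwise true  false = z≤n
    pointwise false true  = ≤-refl
    pointwise false false = z≤n

  markov : ∀ {n} (h : Fin n → ℕ) {a} c → (∀ i → a ≤ h i) →
    n * a + c * ∣ tabulate (λ i → a + c <ᵇ h i) ∣ ≤ ∑[ i < n ] h i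
  markov {n} h {a} c a≤h = begin
    n * a + c * ∣ tabulate bad ∣               ≡⟨ cong₂ _+_ (sym (∑-const n a)) (cong (c *_) (∣tabulate∣ bad)) ⟩
    ∑[ i < n ] a + c * ∑[ i < n ] 𝟙 (bad i)    ≡⟨ cong (∑[ i < n ] a +_) (*-distribˡ-sum c (𝟙 ∘ bad)) ⟩
    ∑[ i < n ] a + ∑[ i < n ] (c * 𝟙 (bad i))  ≡⟨ sym (∑-distrib-+ (λ _ → a) (λ i → c * 𝟙 (bad i))) ⟩
    ∑[ i < n ] (a + c * 𝟙 (bad i))             ≤⟨ ∑-mono-≤ pointwise ⟩
    ∑[ i < n ] h i                             ∎
    where
    open ≤-Reasoning
    bad : Fin n → Bool
    bad i = a + c <ᵇ h i
    pointwise : ∀ i → a + c * 𝟙 (bad i) ≤ h i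
    pointwise i with a + c <ᵇ h i in eq
    ... | true  = subst (_≤ h i) (cong (a +_) (sym (*-identityʳ c)))
                    (<⇒≤ (<ᵇ⇒< (a + c) (h i) (Equivalence.from T-≡ eq)))
    ... | false = subst (_≤ h i) (sym (trans (cong (a +_) (*-zeroʳ c)) (+-identityʳ a))) (a≤h i)

module Tournaments where
  open Counting
  open import Data.Bool using (true; false; not; _∧_)
  open import Data.Fin using (Fin; punchIn)
  open import Data.Fin.Properties using (punchInᵢ≢i)
  open import Data.Fin.Subset using (_∈_; ∣_∣)
  open import Data.Fin.Subset.Properties using (∈⊤; ∣⊤∣≡n)
  open import Data.Nat
  open import Data.Nat.Properties
  open import Data.Product using (_,_)
  open import Data.Vec using (lookup)
  open import Data.Vec.Properties using ([]=⇒lookup)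
  open import Function.Base using (_∘′_)
  open import Relation.Binary.PropositionalEquality

  𝟙-split : ∀ s b → 𝟙 (s ∧ b) + 𝟙 (s ∧ not b) ≡ 𝟙 s
  𝟙-split true  true  = refl
  𝟙-split true  false = refl
  𝟙-split false b     = refl

  -- Every other vertex of S is exactly one of an out- or an in-neighbour of v.
  outdegIn+indegIn : ∀ {n} {adj : Digraph n} → IsTournament adj → ∀ {S v} → v ∈ S →
    suc (outdegIn adj S v + indegIn adj S v) ≡ ∣ S ∣
  outdegIn+indegIn {suc n} {adj} (loopless , oriented) {S} {v} v∈S = begin
    suc (outdegIn adj S v + indegIn adj S v)
      ≡⟨ cong suc (cong₂ _+_ (∣∩asSubset∣ S (adj v)) (∣∩asSubset∣ S (λ j → adj j v))) ⟩
    suc (sum out + sum in′)      ≡⟨ cong suc (sym (∑-distrib-+ out in′)) ⟩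
    suc (sum nbr)                ≡⟨ cong suc (sum-remove {i = v} nbr) ⟩
    suc (nbr v + sum (λ j → nbr (punchIn v j)))
      ≡⟨ cong suc (cong₂ _+_ nbr[v]≡0 (sum-cong-≗ λ j → nbr-other (punchIn v j) (punchInᵢ≢i v j ∘′ sym))) ⟩
    suc (sum (λ j → mem (punchIn v j)))
      ≡⟨ cong (_+ sum (λ j → mem (punchIn v j))) (cong 𝟙 (sym ([]=⇒lookup v∈S))) ⟩
    mem v + sum (λ j → mem (punchIn v j)) ≡⟨ sym (sum-remove {i = v} mem) ⟩
    sum mem                      ≡⟨ sym (∣p∣≡∑𝟙 S) ⟩
    ∣ S ∣                        ∎
    where
    open ≡-Reasoning
    mem out in′ nbr : Fin (suc n) → ℕ
    mem j = 𝟙 (lookup S j)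
    out j = 𝟙 (lookup S j ∧ adj v j)
    in′ j = 𝟙 (lookup S j ∧ adj j v)
    nbr j = out j + in′ j
    nbr[v]≡0 : nbr v ≡ 0
    nbr[v]≡0 rewrite loopless v with lookup S v
    ... | true  = refl
    ... | false = refl
    nbr-other : ∀ j → v ≢ j → nbr j ≡ mem j
    nbr-other j v≢j rewrite oriented v j v≢j = 𝟙-split (lookup S j) (adj v j)

  d⁺+d⁻ : ∀ {n} {adj : Digraph n} → IsTournament adj → ∀ v → suc (d⁺ adj v + d⁻ adj v) ≡ n
  d⁺+d⁻ {n} tour v = trans (outdegIn+indegIn tour ∈⊤) (∣⊤∣≡n n)

  ∑d⁺≡∑d⁻ : ∀ {n} (adj : Digraph n) → ∑[ v < n ] d⁺ adj v ≡ ∑[ v < n ] d⁻ adj v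
  ∑d⁺≡∑d⁻ {n} adj = begin
    ∑[ v < n ] d⁺ adj v                   ≡⟨ sum-cong-≗ (λ v → ∣⊤∩asSubset∣ (adj v)) ⟩
    ∑[ v < n ] ∑[ j < n ] 𝟙 (adj v j)     ≡⟨ ∑-comm (λ v j → 𝟙 (adj v j)) ⟩
    ∑[ j < n ] ∑[ v < n ] 𝟙 (adj v j)     ≡⟨ sym (sum-cong-≗ (λ j → ∣⊤∩asSubset∣ (λ v → adj v j))) ⟩
    ∑[ j < n ] d⁻ adj j                   ∎
    where open ≡-Reasoning

  handshake : ∀ {n} {adj : Digraph n} → IsTournament adj → n + 2 * ∑[ v < n ] d⁺ adj v ≡ n * n
  handshake {n} {adj} tour = begin
    n + 2 * D                                  ≡⟨ cong (n +_) (cong (D +_) (trans (+-identityʳ D) (∑d⁺≡∑d⁻ adj))) ⟩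
    n + (D + ∑[ v < n ] d⁻ adj v)
      ≡⟨ cong₂ _+_ (trans (sym (*-identityʳ n)) (sym (∑-const n 1))) (sym (∑-distrib-+ (d⁺ adj) (d⁻ adj))) ⟩
    ∑[ v < n ] 1 + ∑[ v < n ] (d⁺ adj v + d⁻ adj v) ≡⟨ sym (∑-distrib-+ (λ _ → 1) (λ v → d⁺ adj v + d⁻ adj v)) ⟩
    ∑[ v < n ] suc (d⁺ adj v + d⁻ adj v)       ≡⟨ sum-cong-≗ (d⁺+d⁻ tour) ⟩
    ∑[ v < n ] n                               ≡⟨ ∑-const n n ⟩
    n * n                                      ∎
    where
    open ≡-Reasoning
    D = ∑[ v < n ] d⁺ adj v

module Cleaning where
  open Counting
  open Tournaments
  open Arithmetic
  open import Data.Bool.Properties using (T-≡)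
  open import Data.Fin using (Fin)
  open import Data.Fin.Subset using (Subset; _∈_; ∣_∣; ∁)
  open import Data.Fin.Subset.Properties using (x∈∁p⇒x∉p)
  open import Data.Nat
  open import Data.Nat.Properties
  open import Data.Product using (_×_; _,_; ∃-syntax)
  open import Data.Vec using (tabulate)
  open import Function.Bundles using (Equivalence)
  open import Relation.Binary.PropositionalEquality

  -- The analogue of AlmostRegularOn for γ = 1/k.
  AlmostRegular : ∀ {n} → ℕ → Digraph n → Subset n → Set
  AlmostRegular k adj S = ∀ v → v ∈ S →
    AlmostHalf≥ k (∣ S ∣ ∸ 1) (outdegIn adj S v) × AlmostHalf≥ k (∣ S ∣ ∸ 1) (indegIn adj S v)

  almostRegular-subtournament : ∀ {m} .{{_ : NonZero m}} {adj : Digraph (suc m)} → IsTournament adj → ∀ l →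
    (∀ v → AlmostHalf≥ (16 * suc l * suc l) m (d⁺ adj v)) →
    ∃[ S ] (AlmostRegular (suc l) adj S × AlmostAll (suc l) (suc m) ∣ S ∣)
  almostRegular-subtournament {m} {adj} tour l d⁺≥ = ∁ B , regular , size
    where
    L K n : ℕ
    L = suc l
    K = 16 * L * L
    n = suc m
    excess : Fin n → ℕ
    excess v = 2 * L * (2 * K * d⁺ adj v + m)
    threshold = 2 * L * (K * m) + K * m
    B : Subset n
    B = tabulate (λ v → threshold <ᵇ excess v)
    b = ∣ B ∣
    D = ∑[ v < n ] d⁺ adj v
    ∑excess : ∑[ v < n ] excess v ≡ 2 * L * (2 * K * D + n * m)
    ∑excess = begin
      ∑[ v < n ] excess v                           ≡⟨ sym (*-distribˡ-sum (2 * L) (λ v → 2 * K * d⁺ adj v + m)) ⟩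
      2 * L * ∑[ v < n ] (2 * K * d⁺ adj v + m)
        ≡⟨ cong (2 * L *_) (∑-distrib-+ (λ v → 2 * K * d⁺ adj v) (λ _ → m)) ⟩
      2 * L * (∑[ v < n ] (2 * K * d⁺ adj v) + ∑[ v < n ] m)
        ≡⟨ cong (2 * L *_) (cong₂ _+_ (sym (*-distribˡ-sum (2 * K) (d⁺ adj))) (∑-const n m)) ⟩
      2 * L * (2 * K * D + n * m)                   ∎
      where open ≡-Reasoning
    markov-bound : n * (2 * L * (K * m)) + K * m * b ≤ 2 * L * (2 * K * D + n * m)
    markov-bound = subst (n * (2 * L * (K * m)) + K * m * b ≤_) ∑excess
      (markov excess (K * m) (λ v → *-monoʳ-≤ (2 * L) (AlmostHalf≥.cleared (d⁺≥ v))))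
    few : 4 * L * b ≤ m
    few = 16L²b≤2Ln⇒4Lb≤m {l} (>-nonZero⁻¹ m)
      (markov-bound⇒Kb≤2Ln {L} {K} {m} {b} {D} markov-bound (handshake tour))
    ∣∁B∣+b≡n : ∣ ∁ B ∣ + b ≡ n
    ∣∁B∣+b≡n = ∣∁p∣+∣p∣≡n B
    regular : AlmostRegular L adj (∁ B)
    regular v v∈S = subst (λ t → AlmostHalf≥ L t o) t≡ out , subst (λ t → AlmostHalf≥ L t i) t≡ in′
      where
      o = outdegIn adj (∁ B) v
      i = indegIn adj (∁ B) v
      suc[o+i]≡∣S∣ = outdegIn+indegIn tour v∈S
      t≡ : o + i ≡ ∣ ∁ B ∣ ∸ 1
      t≡ = cong (_∸ 1) suc[o+i]≡∣S∣
      t+b≡m : o + i + b ≡ m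
      t+b≡m = suc-injective (trans (cong (_+ b) suc[o+i]≡∣S∣) ∣∁B∣+b≡n)
      below : excess v ≤ threshold
      below = ≮⇒≥ λ above → x∈∁p⇒x∉p v∈S
        (∈-tabulate (λ u → threshold <ᵇ excess u) (Equivalence.to T-≡ (<⇒<ᵇ above)))
      out : AlmostHalf≥ L (o + i) o
      out = outdeg-after-deletion (s≤s z≤n) (2L≤16L² l) (d⁺≥ v) (∣⊤∩q∣≤∣∁r∩q∣+∣r∣ (outNbhd adj v) B) t+b≡m few
      in′ : AlmostHalf≥ L (o + i) i
      in′ = indeg-after-deletion (s≤s z≤n) (below-threshold⇒AlmostHalf≤ {L} {K} below)
        (∣p∩q∣≤∣⊤∩q∣ (∁ B) (outNbhd adj v)) refl t+b≡m few
    size : AlmostAll L n ∣ ∁ B ∣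
    size = AlmostAll-by-complement {L} ∣∁B∣+b≡n (≤-trans (*-monoˡ-≤ b (m≤n*m L 4)) (≤-trans few (n≤1+n m)))

module Rationals where
  open Arithmetic
  open import Data.Integer as ℤ using (+_)
  import Data.Integer.Properties as ℤ
  open import Data.List using (_∷_; [])
  open import Data.Nat as ℕ using (ℕ; suc)
  open import Data.Nat.Coprimality using (1-coprimeTo) renaming (sym to coprime-sym)
  open import Data.Nat.Tactic.RingSolver using () renaming (solve to ℕ-solve)
  open import Data.Product using (∃-syntax; _,_; _×_)
  open import Data.Rational
  open import Data.Rational.Properties
  open import Data.Rational.Solver using (module +-*-Solver)
  import Data.Rational.Unnormalised as ℚᵘ
  import Data.Rational.Unnormalised.Properties as ℚᵘ
  open import Relation.Binary.PropositionalEquality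
  open +-*-Solver using (solve; _:+_; _:-_; _:*_; _:=_; con)

  toℚᵘ-ℕ→ℚ : ∀ k → toℚᵘ (ℕ→ℚ k) ≡ ℚᵘ.mkℚᵘ (+ k) 0
  toℚᵘ-ℕ→ℚ k = cong toℚᵘ (normalize-coprime (coprime-sym (1-coprimeTo k)))

  ℕ→ℚ-+ : ∀ a b → ℕ→ℚ (a ℕ.+ b) ≡ ℕ→ℚ a + ℕ→ℚ b
  ℕ→ℚ-+ a b = toℚᵘ-injective (begin
    toℚᵘ (ℕ→ℚ (a ℕ.+ b))                ≡⟨ toℚᵘ-ℕ→ℚ (a ℕ.+ b) ⟩
    ℚᵘ.mkℚᵘ (+ (a ℕ.+ b)) 0              ≈⟨ ℚᵘ.*≡* (cong (ℤ._* + 1) (trans (ℤ.pos-+ a b)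
                                              (sym (cong₂ ℤ._+_ (ℤ.*-identityʳ (+ a)) (ℤ.*-identityʳ (+ b)))))) ⟩
    ℚᵘ.mkℚᵘ (+ a) 0 ℚᵘ.+ ℚᵘ.mkℚᵘ (+ b) 0 ≡⟨ sym (cong₂ ℚᵘ._+_ (toℚᵘ-ℕ→ℚ a) (toℚᵘ-ℕ→ℚ b)) ⟩
    toℚᵘ (ℕ→ℚ a) ℚᵘ.+ toℚᵘ (ℕ→ℚ b)       ≈⟨ ℚᵘ.≃-sym (toℚᵘ-homo-+ (ℕ→ℚ a) (ℕ→ℚ b)) ⟩
    toℚᵘ (ℕ→ℚ a + ℕ→ℚ b)                ∎)
    where open ℚᵘ.≃-Reasoning

  ℕ→ℚ-* : ∀ a b → ℕ→ℚ (a ℕ.* b) ≡ ℕ→ℚ a * ℕ→ℚ b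
  ℕ→ℚ-* a b = toℚᵘ-injective (begin
    toℚᵘ (ℕ→ℚ (a ℕ.* b))                ≡⟨ toℚᵘ-ℕ→ℚ (a ℕ.* b) ⟩
    ℚᵘ.mkℚᵘ (+ (a ℕ.* b)) 0              ≈⟨ ℚᵘ.*≡* (cong (ℤ._* + 1) (ℤ.pos-* a b)) ⟩
    ℚᵘ.mkℚᵘ (+ a) 0 ℚᵘ.* ℚᵘ.mkℚᵘ (+ b) 0 ≡⟨ sym (cong₂ ℚᵘ._*_ (toℚᵘ-ℕ→ℚ a) (toℚᵘ-ℕ→ℚ b)) ⟩
    toℚᵘ (ℕ→ℚ a) ℚᵘ.* toℚᵘ (ℕ→ℚ b)       ≈⟨ ℚᵘ.≃-sym (toℚᵘ-homo-* (ℕ→ℚ a) (ℕ→ℚ b)) ⟩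
    toℚᵘ (ℕ→ℚ a * ℕ→ℚ b)                ∎)
    where open ℚᵘ.≃-Reasoning

  ℕ→ℚ-mono-≤ : ∀ {a b} → a ℕ.≤ b → ℕ→ℚ a ≤ ℕ→ℚ b
  ℕ→ℚ-mono-≤ {a} {b} a≤b = toℚᵘ-cancel-≤ (subst₂ ℚᵘ._≤_ (sym (toℚᵘ-ℕ→ℚ a)) (sym (toℚᵘ-ℕ→ℚ b))
    (ℚᵘ.*≤* (ℤ.*-monoʳ-≤-nonNeg (+ 1) (ℤ.+≤+ a≤b))))

  ℕ→ℚ-cancel-≤ : ∀ {a b} → ℕ→ℚ a ≤ ℕ→ℚ b → a ℕ.≤ b
  ℕ→ℚ-cancel-≤ {a} {b} a≤b with subst₂ ℚᵘ._≤_ (toℚᵘ-ℕ→ℚ a) (toℚᵘ-ℕ→ℚ b) (toℚᵘ-mono-≤ a≤b)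
  ... | ℚᵘ.*≤* a≤b′ = ℤ.drop‿+≤+ (subst₂ ℤ._≤_ (ℤ.*-identityʳ (+ a)) (ℤ.*-identityʳ (+ b)) a≤b′)

  ℕ→ℚ-nonNeg : ∀ k → NonNegative (ℕ→ℚ k)
  ℕ→ℚ-nonNeg k = subst ℚᵘ.NonNegative (sym (toℚᵘ-ℕ→ℚ k)) _

  ℕ→ℚ-pos : ∀ k → Positive (ℕ→ℚ (suc k))
  ℕ→ℚ-pos k = subst ℚᵘ.Positive (sym (toℚᵘ-ℕ→ℚ (suc k))) _

  ℕ→ℚ-suc-1 : ∀ k → ℕ→ℚ (suc k) - 1ℚ ≡ ℕ→ℚ k
  ℕ→ℚ-suc-1 k =
    trans (cong (_- 1ℚ) (ℕ→ℚ-+ 1 k)) (solve 1 (λ x → (con 1ℚ :+ x) :- con 1ℚ := x) refl (ℕ→ℚ k))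

  ℕ→ℚ-∸1 : ∀ {s} → 1 ℕ.≤ s → ℕ→ℚ s - 1ℚ ≡ ℕ→ℚ (s ℕ.∸ 1)
  ℕ→ℚ-∸1 {suc t} _ = ℕ→ℚ-suc-1 t

  ℕ→ℚ-2k*d+m : ∀ k d m → ℕ→ℚ (2 ℕ.* k ℕ.* d ℕ.+ m) ≡ ℕ→ℚ (2 ℕ.* k) * ℕ→ℚ d + 1ℚ * ℕ→ℚ m
  ℕ→ℚ-2k*d+m k d m =
    trans (ℕ→ℚ-+ (2 ℕ.* k ℕ.* d) m) (cong₂ _+_ (ℕ→ℚ-* (2 ℕ.* k) d) (sym (*-identityˡ (ℕ→ℚ m))))

  AlmostHalf≥-from-ℚ : ∀ {α K m d} → α * ℕ→ℚ K ≤ 1ℚ →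
    (1ℚ - α) * (ℕ→ℚ (suc m) - 1ℚ) * ½ ≤ ℕ→ℚ d → AlmostHalf≥ K m d
  AlmostHalf≥-from-ℚ {α} {K} {m} {d} αK≤1 d≥ = almostHalf≥ (ℕ→ℚ-cancel-≤ (begin
    ℕ→ℚ (K ℕ.* m)                                ≡⟨ ℕ→ℚ-* K m ⟩
    K′ * m′
      ≡⟨ solve 3 (λ k x a → k :* x := (con (ℕ→ℚ 2) :* k) :* ((con 1ℚ :- a) :* x :* con ½) :+ (a :* k) :* x)
           refl K′ m′ α ⟩
    ℕ→ℚ 2 * K′ * ((1ℚ - α) * m′ * ½) + α * K′ * m′
      ≡⟨ cong (λ x → x * ((1ℚ - α) * m′ * ½) + α * K′ * m′) (sym (ℕ→ℚ-* 2 K)) ⟩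
    2K′ * ((1ℚ - α) * m′ * ½) + α * K′ * m′
      ≤⟨ +-mono-≤ (*-monoˡ-≤-nonNeg 2K′ {{ℕ→ℚ-nonNeg (2 ℕ.* K)}} d≥′) (*-monoʳ-≤-nonNeg m′ {{ℕ→ℚ-nonNeg m}} αK≤1) ⟩
    2K′ * ℕ→ℚ d + 1ℚ * m′                        ≡⟨ sym (ℕ→ℚ-2k*d+m K d m) ⟩
    ℕ→ℚ (2 ℕ.* K ℕ.* d ℕ.+ m)                    ∎))
    where
    open ≤-Reasoning
    K′ = ℕ→ℚ K
    2K′ = ℕ→ℚ (2 ℕ.* K)
    m′ = ℕ→ℚ m
    d≥′ : (1ℚ - α) * m′ * ½ ≤ ℕ→ℚ d
    d≥′ = subst (λ x → (1ℚ - α) * x * ½ ≤ ℕ→ℚ d) (ℕ→ℚ-suc-1 m) d≥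

  AlmostHalf≤-from-ℚ : ∀ {α K m d} → α * ℕ→ℚ K ≤ 1ℚ →
    ℕ→ℚ d ≤ (1ℚ + α) * (ℕ→ℚ (suc m) - 1ℚ) * ½ → AlmostHalf≤ K m d
  AlmostHalf≤-from-ℚ {α} {K} {m} {d} αK≤1 d≤ = almostHalf≤ (ℕ→ℚ-cancel-≤ (begin
    ℕ→ℚ (2 ℕ.* K ℕ.* d)                          ≡⟨ ℕ→ℚ-* (2 ℕ.* K) d ⟩
    2K′ * ℕ→ℚ d                                  ≤⟨ *-monoˡ-≤-nonNeg 2K′ {{ℕ→ℚ-nonNeg (2 ℕ.* K)}} d≤′ ⟩
    2K′ * ((1ℚ + α) * m′ * ½)                    ≡⟨ cong (_* ((1ℚ + α) * m′ * ½)) (ℕ→ℚ-* 2 K) ⟩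
    ℕ→ℚ 2 * K′ * ((1ℚ + α) * m′ * ½)             ≡⟨ solve 3 (λ k x a →
                                                      (con (ℕ→ℚ 2) :* k) :* ((con 1ℚ :+ a) :* x :* con ½) :=
                                                      k :* x :+ (a :* k) :* x) refl K′ m′ α ⟩
    K′ * m′ + α * K′ * m′                        ≤⟨ +-monoʳ-≤ (K′ * m′) (*-monoʳ-≤-nonNeg m′ {{ℕ→ℚ-nonNeg m}} αK≤1) ⟩
    K′ * m′ + 1ℚ * m′                            ≡⟨ cong₂ _+_ (sym (ℕ→ℚ-* K m)) (*-identityˡ m′) ⟩
    ℕ→ℚ (K ℕ.* m) + m′                           ≡⟨ sym (ℕ→ℚ-+ (K ℕ.* m) m) ⟩
    ℕ→ℚ (K ℕ.* m ℕ.+ m)                          ∎))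
    where
    open ≤-Reasoning
    K′ = ℕ→ℚ K
    2K′ = ℕ→ℚ (2 ℕ.* K)
    m′ = ℕ→ℚ m
    d≤′ : ℕ→ℚ d ≤ (1ℚ + α) * m′ * ½
    d≤′ = subst (λ x → ℕ→ℚ d ≤ (1ℚ + α) * x * ½) (ℕ→ℚ-suc-1 m) d≤

  [1-γ]xL≤Lx-x : ∀ γ L x .{{_ : NonNegative x}} → 1ℚ ≤ γ * L → (1ℚ - γ) * x * L ≤ L * x - 1ℚ * x
  [1-γ]xL≤Lx-x γ L x γL≥1 = begin
    (1ℚ - γ) * x * L    ≡⟨ solve 3 (λ g l y → (con 1ℚ :- g) :* y :* l := l :* y :- (g :* l) :* y) refl γ L x ⟩
    L * x - γ * L * x   ≤⟨ +-monoʳ-≤ (L * x) (neg-antimono-≤ (*-monoʳ-≤-nonNeg x γL≥1)) ⟩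
    L * x - 1ℚ * x      ∎
    where open ≤-Reasoning

  AlmostHalf≥-to-ℚ : ∀ {γ l t o} → 1ℚ ≤ γ * ℕ→ℚ (suc l) →
    AlmostHalf≥ (suc l) t o → (1ℚ - γ) * ℕ→ℚ t * ½ ≤ ℕ→ℚ o
  AlmostHalf≥-to-ℚ {γ} {l} {t} {o} γL≥1 (almostHalf≥ o≥) =
    *-cancelʳ-≤-pos 2L′ {{ℕ→ℚ-pos (l ℕ.+ 1 ℕ.* suc l)}} (begin
    (1ℚ - γ) * t′ * ½ * 2L′                    ≡⟨ cong ((1ℚ - γ) * t′ * ½ *_) (ℕ→ℚ-* 2 L) ⟩
    (1ℚ - γ) * t′ * ½ * (ℕ→ℚ 2 * L′)           ≡⟨ solve 3 (λ g y l →
                                                    (con 1ℚ :- g) :* y :* con ½ :* (con (ℕ→ℚ 2) :* l) :=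
                                                    (con 1ℚ :- g) :* y :* l) refl γ t′ L′ ⟩
    (1ℚ - γ) * t′ * L′                         ≤⟨ [1-γ]xL≤Lx-x γ L′ t′ {{ℕ→ℚ-nonNeg t}} γL≥1 ⟩
    L′ * t′ - 1ℚ * t′                          ≡⟨ cong (_- 1ℚ * t′) (sym (ℕ→ℚ-* L t)) ⟩
    ℕ→ℚ (L ℕ.* t) - 1ℚ * t′                    ≤⟨ +-monoˡ-≤ (- (1ℚ * t′)) (ℕ→ℚ-mono-≤ o≥) ⟩
    ℕ→ℚ (2 ℕ.* L ℕ.* o ℕ.+ t) - 1ℚ * t′        ≡⟨ cong (_- 1ℚ * t′) (ℕ→ℚ-2k*d+m L o t) ⟩
    2L′ * o′ + 1ℚ * t′ - 1ℚ * t′               ≡⟨ solve 3 (λ k y z → k :* y :+ con 1ℚ :* z :- con 1ℚ :* z := y :* k)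
                                                    refl 2L′ o′ t′ ⟩
    o′ * 2L′                                   ∎)
    where
    open ≤-Reasoning
    L = suc l
    L′ = ℕ→ℚ L
    2L′ = ℕ→ℚ (2 ℕ.* L)
    t′ = ℕ→ℚ t
    o′ = ℕ→ℚ o

  AlmostAll-to-ℚ : ∀ {γ l n s} → 1ℚ ≤ γ * ℕ→ℚ (suc l) →
    AlmostAll (suc l) n s → (1ℚ - γ) * ℕ→ℚ n ≤ ℕ→ℚ s
  AlmostAll-to-ℚ {γ} {l} {n} {s} γL≥1 (almostAll s≥) = *-cancelʳ-≤-pos L′ {{ℕ→ℚ-pos l}} (begin
    (1ℚ - γ) * n′ * L′                  ≤⟨ [1-γ]xL≤Lx-x γ L′ n′ {{ℕ→ℚ-nonNeg n}} γL≥1 ⟩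
    L′ * n′ - 1ℚ * n′                   ≡⟨ cong (_- 1ℚ * n′) (sym (ℕ→ℚ-* L n)) ⟩
    ℕ→ℚ (L ℕ.* n) - 1ℚ * n′             ≤⟨ +-monoˡ-≤ (- (1ℚ * n′)) (ℕ→ℚ-mono-≤ s≥) ⟩
    ℕ→ℚ (L ℕ.* s ℕ.+ n) - 1ℚ * n′
      ≡⟨ cong (_- 1ℚ * n′) (trans (ℕ→ℚ-+ (L ℕ.* s) n) (cong₂ _+_ (ℕ→ℚ-* L s) (sym (*-identityˡ n′)))) ⟩
    L′ * s′ + 1ℚ * n′ - 1ℚ * n′         ≡⟨ solve 3 (λ k y z → k :* y :+ con 1ℚ :* z :- con 1ℚ :* z := y :* k)
                                             refl L′ s′ n′ ⟩
    s′ * L′                             ∎)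
    where
    open ≤-Reasoning
    L = suc l
    L′ = ℕ→ℚ L
    n′ = ℕ→ℚ n
    s′ = ℕ→ℚ s

  archimedean : ∀ γ → 0ℚ < γ → ∃[ l ] 1ℚ ≤ γ * ℕ→ℚ (suc l)
  archimedean (mkℚ ℤ.-[1+ _ ] _ _) (*<* ())
  archimedean (mkℚ (+ 0) _ _) (*<* (ℤ.+<+ ()))
  archimedean γ@(mkℚ (+ suc p) l _) _ = l , (begin
    1ℚ                    ≤⟨ ℕ→ℚ-mono-≤ {1} {suc p} (ℕ.s≤s ℕ.z≤n) ⟩
    ℕ→ℚ (suc p)           ≡⟨ sym γ*denominator ⟩
    γ * ℕ→ℚ (suc l)       ∎)
    where
    open ≤-Reasoning
    γ*denominator : γ * ℕ→ℚ (suc l) ≡ ℕ→ℚ (suc p)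
    γ*denominator = toℚᵘ-injective (ℚᵘ.≃-trans (toℚᵘ-homo-* γ (ℕ→ℚ (suc l)))
      (subst₂ ℚᵘ._≃_ (sym (cong (toℚᵘ γ ℚᵘ.*_) (toℚᵘ-ℕ→ℚ (suc l)))) (sym (toℚᵘ-ℕ→ℚ (suc p)))
        (ℚᵘ.*≡* (cong (λ x → + suc x) (ℕ-solve (l ∷ p ∷ []))))))

  unit-fraction : ∀ k → ∃[ α₀ ] (0ℚ < α₀ × (∀ {α} → α ≤ α₀ → α * ℕ→ℚ (suc k) ≤ 1ℚ))
  unit-fraction k = 1/ K′ , positive⁻¹ (1/ K′) {{1/pos⇒pos K′}} , λ {α} α≤α₀ → begin
    α * K′       ≤⟨ *-monoʳ-≤-nonNeg K′ α≤α₀ ⟩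
    1/ K′ * K′   ≡⟨ *-inverseˡ K′ ⟩
    1ℚ           ∎
    where
    open ≤-Reasoning
    K′ = ℕ→ℚ (suc k)
    instance
      K′-pos = ℕ→ℚ-pos k
      K′-nonNeg = ℕ→ℚ-nonNeg (suc k)
      K′-nonZero = pos⇒nonZero K′

open import Data.Nat using (ℕ) renaming (_≥_ to _≥ℕ_)
open import Data.Fin.Subset using (Subset; ∣_∣)
open import Data.Rational using (ℚ; _<_; _≤_; _*_; _-_; 0ℚ; 1ℚ)
open import Data.Product using (Σ; _×_; ∃-syntax)

open Arithmetic
open Cleaning
open Rationals
open Tournaments using (d⁺+d⁻)
open import Data.Fin.Subset.Properties using (x∈p⇒∣p-x∣<∣p∣)
open import Data.Nat using (suc; zero; NonZero; s≤s; z≤n; _∸_)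
open import Data.Nat.Properties using (suc-injective; ≤-trans)
open import Data.Product using (_,_; swap)
open import Data.Rational using (½)
open import Data.Sum using (_⊎_; inj₁; inj₂)
open import Function using (_∘_; case_of_)
open import Relation.Binary.PropositionalEquality using (sym; subst)
import Data.Nat as ℕ
import Data.Rational as Q
import Data.Integer as ℤ

reverse : ∀ {n} → Digraph n → Digraph n
reverse adj u v = adj v u

reverse-tournament : ∀ {n} {adj : Digraph n} → IsTournament adj → IsTournament (reverse adj)
reverse-tournament (loopless , oriented) = loopless , λ i j i≢j → oriented j i (i≢j ∘ sym)

degree-condition⇒min-degree : ∀ {m α K} {adj : Digraph (suc m)} → IsTournament adj →
  α * ℕ→ℚ K ≤ 1ℚ → DegreeCondition α adj →
  (∀ v → AlmostHalf≥ K m (d⁺ adj v)) ⊎ (∀ v → AlmostHalf≥ K m (d⁺ (reverse adj) v))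
degree-condition⇒min-degree {α = α} {K} tour αK≤1 (inj₁ d⁺≥) =
  inj₁ (AlmostHalf≥-from-ℚ {α} {K} αK≤1 ∘ d⁺≥)
degree-condition⇒min-degree {α = α} {K} tour αK≤1 (inj₂ (inj₁ d⁻≥)) =
  inj₂ (AlmostHalf≥-from-ℚ {α} {K} αK≤1 ∘ d⁻≥)
degree-condition⇒min-degree {α = α} {K} tour αK≤1 (inj₂ (inj₂ (inj₁ d⁺≤))) = inj₂ λ v →
  AlmostHalf≤⇒AlmostHalf≥-complement (suc-injective (d⁺+d⁻ tour v))
    (AlmostHalf≤-from-ℚ {α} {K} αK≤1 (d⁺≤ v))
degree-condition⇒min-degree {α = α} {K} tour αK≤1 (inj₂ (inj₂ (inj₂ d⁻≤))) = inj₁ λ v →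
  AlmostHalf≤⇒AlmostHalf≥-complement (suc-injective (d⁺+d⁻ (reverse-tournament tour) v))
    (AlmostHalf≤-from-ℚ {α} {K} αK≤1 (d⁻≤ v))

AlmostRegular-to-ℚ : ∀ {n γ l} {adj : Digraph n} {S : Subset n} → 1ℚ ≤ γ * ℕ→ℚ (suc l) →
  AlmostRegular (suc l) adj S → AlmostRegularOn γ adj S
AlmostRegular-to-ℚ {γ = γ} {l} {S = S} γL≥1 regular v v∈S with regular v v∈S
... | out≥ , in≥ = to-ℚ out≥ , to-ℚ in≥
  where
  to-ℚ : ∀ {x} → AlmostHalf≥ (suc l) (∣ S ∣ ∸ 1) x → (1ℚ - γ) * (ℕ→ℚ ∣ S ∣ - 1ℚ) * ½ ≤ ℕ→ℚ x
  to-ℚ {x} x≥ = subst (λ y → (1ℚ - γ) * y * ½ ≤ ℕ→ℚ x)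
    (sym (ℕ→ℚ-∸1 (≤-trans (s≤s z≤n) (x∈p⇒∣p-x∣<∣p∣ v∈S)))) (AlmostHalf≥-to-ℚ {γ} {l} γL≥1 x≥)

almostRegularOn-subtournament : ∀ {m} .{{_ : NonZero m}} {adj : Digraph (suc m)} → IsTournament adj →
  ∀ {γ l} → 1ℚ ≤ γ * ℕ→ℚ (suc l) → (∀ v → AlmostHalf≥ (16 ℕ.* suc l ℕ.* suc l) m (d⁺ adj v)) →
  ∃[ S ] (AlmostRegularOn γ adj S × (1ℚ - γ) * ℕ→ℚ (suc m) ≤ ℕ→ℚ ∣ S ∣)
almostRegularOn-subtournament {m} {adj} tour {γ} {l} γL≥1 d⁺≥ =
  let S , regular , large = almostRegular-subtournament {m} {adj} tour l d⁺≥
  in S , AlmostRegular-to-ℚ {γ = γ} {l} {adj} γL≥1 regular , AlmostAll-to-ℚ {γ} {l} γL≥1 large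

proposition2p4 : Σ ℚ λ γ₀ → 0ℚ < γ₀ × ((γ : ℚ) → 0ℚ < γ → γ ≤ γ₀ →
    Σ ℚ λ α₀ → 0ℚ < α₀ × ((α : ℚ) → 0ℚ < α → α ≤ α₀ →
      Σ ℕ λ n₀ → (n : ℕ) → n ≥ℕ n₀ →
        (adj : Digraph n) → IsTournament adj → DegreeCondition α adj →
          ∃[ S ] (AlmostRegularOn γ adj S × (1ℚ - γ) * ℕ→ℚ n ≤ ℕ→ℚ ∣ S ∣)))
proposition2p4 = 1ℚ , Q.*<* (ℤ.+<+ (s≤s z≤n)) , λ γ γ>0 _ →
  let l , γL≥1 = archimedean γ γ>0
      K = 16 ℕ.* suc l ℕ.* suc l
      α₀ , α₀>0 , αK≤1 = unit-fraction (ℕ.pred K)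
  in α₀ , α₀>0 , λ α _ α≤α₀ → 2 , λ where
    zero ()
    (suc zero) (s≤s ())
    (suc (suc m)) _ adj tour condition →
      case degree-condition⇒min-degree {suc m} {α} {K} tour (αK≤1 α≤α₀) condition of λ where
        (inj₁ d⁺≥) → almostRegularOn-subtournament tour {γ} {l} γL≥1 d⁺≥
        (inj₂ d⁻≥) →
          let S , regular , large = almostRegularOn-subtournament (reverse-tournament tour) {γ} {l} γL≥1 d⁻≥
          in S , (λ v v∈S → swap (regular v v∈S)) , large
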